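{- Let $G$ be a bipartite graph with bipartition $\{B,R\}$, where $m:=|B|\ge 1$, $n:=|R|\ge1$ and $m\le n$, and let $k$ be an integer with $1\le k\le m+n-1$. Let $\mathcal R$ (resp. $\mathcal B$) be the set of $k$-subsets $A$ of $V(G)$ with $|R\cap A|$ odd (resp. even). If $\beta(F_k(G))=\max\{|\mathcal R|,|\mathcal B|\}$ and $G'$ is a bipartite graph on the same vertex set with the same bipartition $\{R,B\}$ that contains $G$ as a subgraph, then $\beta(F_k(G'))=\max\{|\mathcal R|,|\mathcal B|\}$.
   Context: For a simple finite graph $G$ of order $N$ and an integer $1\le k\le N-1$, the $k$-token graph $F_k(G)$ is the graph whose vertices are all $k$-element subsets of $V(G)$, two such subsets being adjacent iff their symmetric difference is an edge of $G$. $\beta$ denotes the independence number. -}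

module Defs where

open import Data.Nat using (ℕ; zero; suc; _+_; _%_; _≤_; _<_)
open import Data.Bool using (Bool; true; false; if_then_else_)
open import Data.Fin using (Fin; toℕ)
open import Data.Fin.Subset using (Subset; _∈_; _∉_; ∣_∣)
open import Data.Vec using (Vec; []; _∷_; drop; map)
open import Data.List using (List; []; _∷_; _++_; length)
open import Data.List.Membership.Propositional using () renaming (_∈_ to _∈ₗ_)
open import Data.List.Relation.Unary.All using (All)
open import Data.List.Relation.Unary.Unique.Propositional using (Unique)
open import Data.Product using (Σ; _×_; ∃)
open import Relation.Binary.PropositionalEquality using (_≡_; _≢_)
open import Relation.Nullary using (¬_)
open import Function.Bundles using (_⇔_)

record Graph (N : ℕ) : Set₁ where
  field
    Adj   : Fin N → Fin N → Set
    sym   : ∀ {u v} → Adj u v → Adj v u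
    irrefl : ∀ {u} → ¬ Adj u u
open Graph public

-- Vertex set Fin (m + n); B = the first m vertices, R = the last n vertices.
InB : (m : ℕ) {n : ℕ} → Fin (m + n) → Set
InB m v = toℕ v < m

IsBipartiteBR : (m n : ℕ) → Graph (m + n) → Set
IsBipartiteBR m n G = ∀ u v → Adj G u v → (InB m u × ¬ InB m v) ⊎' (¬ InB m u × InB m v)
  where
    open import Data.Sum using () renaming (_⊎_ to _⊎'_)

Subgraph : ∀ {N} → Graph N → Graph N → Set
Subgraph G G' = ∀ u v → Adj G u v → Adj G' u v

-- Adjacency in the k-token graph F_k(G): the symmetric difference of A and A'
-- is exactly {u, v} for an edge uv of G (u ∈ A ∖ A', v ∈ A' ∖ A).
TokenAdj : ∀ {N} → Graph N → Subset N → Subset N → Set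
TokenAdj G A A' = Σ _ λ u → Σ _ λ v →
  Adj G u v × u ∈ A × u ∉ A' × v ∈ A' × v ∉ A ×
  (∀ w → w ≢ u → w ≢ v → (w ∈ A ⇔ w ∈ A'))

IsTokenIndep : ∀ {N} → Graph N → ℕ → List (Subset N) → Set
IsTokenIndep G k S =
  Unique S × All (λ A → ∣ A ∣ ≡ k) S ×
  (∀ {A A'} → A ∈ₗ S → A' ∈ₗ S → ¬ TokenAdj G A A')

IndepNumberToken : ∀ {N} → Graph N → ℕ → ℕ → Set
IndepNumberToken G k c =
  (∃ λ S → IsTokenIndep G k S × length S ≡ c) ×
  (∀ S → IsTokenIndep G k S → length S ≤ c)

allSubsets : (N : ℕ) → List (Subset N)
allSubsets zero = [] ∷ []
allSubsets (suc N) = Data.List.map (true ∷_) (allSubsets N) ++ Data.List.map (false ∷_) (allSubsets N)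
  where import Data.List

countᵇ : ∀ {a} {A : Set a} → (A → Bool) → List A → ℕ
countᵇ p [] = 0
countᵇ p (x ∷ xs) = if p x then suc (countᵇ p xs) else countᵇ p xs

-- |R ∩ A| where R is the last n vertices.
rSize : (m : ℕ) {n : ℕ} → Subset (m + n) → ℕ
rSize m A = ∣ drop m A ∣

isK : ℕ → ∀ {N} → Subset N → Bool
isK k A = Data.Nat.Base._≡ᵇ_ ∣ A ∣ k
  where import Data.Nat.Base

isOdd : ℕ → Bool
isOdd x = Data.Nat.Base._≡ᵇ_ (x % 2) 1
  where import Data.Nat.Base

countR : (m n k : ℕ) → ℕ
countR m n k = countᵇ (λ A → if isK k A then isOdd (rSize m {n} A) else false) (allSubsets (m + n))

countB : (m n k : ℕ) → ℕ
countB m n k = countᵇ (λ A → if isK k A then Data.Bool.not (isOdd (rSize m {n} A)) else false) (allSubsets (m + n))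
  where import Data.Bool

-- If A ~ A' in F_k of a bipartite graph, a token moves along an edge between B and R, so
-- |R ∩ A| and |R ∩ A'| differ by one. Hence each parity class 𝓡, 𝓑 is independent in F_k of
-- every bipartite graph, in particular of G', giving β(F_k(G')) ≥ max{|𝓡|, |𝓑|}. Conversely an
-- independent set of F_k(G') is independent in F_k(G) since G ⊆ G', so β(F_k(G')) ≤ β(F_k(G)).
module Submission where

open import Defs
open import Data.Nat using (ℕ; zero; suc; _+_; _∸_; _≤_; _<_; _⊔_)
open import Data.Nat.Properties
  using (≡ᵇ⇒≡; ≮⇒≥; ≤-total; m≤n⇒m⊔n≡n; m≥n⇒m⊔n≡m; m≤m+n; <⇒≢; <-≤-trans)
open import Data.Bool using (Bool; true; false; if_then_else_; not; T)
open import Data.Bool.Properties using (not-¬; T-≡; T-not-≡)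
open import Data.Fin using (Fin; zero; suc; toℕ; _↑ʳ_; reduce≥)
open import Data.Fin.Properties using (suc-injective; ↑ʳ-injective; toℕ-↑ʳ; splitAt-≥; splitAt⁻¹-↑ʳ)
open import Data.Fin.Subset using (Subset; _∈_; _∉_; ∣_∣; inside; outside)
open import Data.Fin.Subset.Properties using (⊆-antisym; drop-there)
open import Data.Vec using (_∷_; drop; here; there)
open import Data.Unit using (tt)
open import Data.List using (List; []; _∷_; length; map; filterᵇ)
open import Data.List.Membership.Propositional using () renaming (_∈_ to _∈ₗ_)
open import Data.List.Membership.Propositional.Properties using (∈-map⁻; ∈-filter⁻)
import Data.List.Relation.Unary.All as All
open All using ([])
open import Data.List.Relation.Unary.AllPairs using ([]; _∷_)
open import Data.List.Relation.Unary.Unique.Propositional using (Unique)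
import Data.List.Relation.Unary.Unique.Propositional.Properties as Unique
open import Data.Product using (_×_; ∃; _,_; proj₁; proj₂)
open import Data.Sum using (inj₁; inj₂)
open import Relation.Binary.PropositionalEquality
  using (_≡_; _≢_; refl; trans; cong; subst)
import Relation.Binary.PropositionalEquality as ≡
open import Relation.Nullary using (¬_; contradiction; T?)
open import Function using (_∘_)
open import Function.Bundles using (_⇔_; mk⇔; Equivalence)
import Function.Properties.Equivalence as ⇔
open import Function.Related.Propositional using (module EquationalReasoning; equivalence)

open Equivalence using (to; from)

∷-⇔⁻ : ∀ {L} {q : Fin L} {x y : Bool} {X Y : Subset L} →
  (suc q ∈ x ∷ X ⇔ suc q ∈ y ∷ Y) → (q ∈ X ⇔ q ∈ Y)
∷-⇔⁻ h = mk⇔ (drop-there ∘ to h ∘ there) (drop-there ∘ from h ∘ there)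

∣∣-cong : ∀ {L} {X Y : Subset L} → (∀ q → q ∈ X ⇔ q ∈ Y) → ∣ X ∣ ≡ ∣ Y ∣
∣∣-cong X≈Y = cong ∣_∣ (⊆-antisym (to (X≈Y _)) (from (X≈Y _)))

agree-off-suc⁻ : ∀ {L} {p : Fin L} {x y : Bool} {X Y : Subset L} →
  (∀ q → q ≢ suc p → q ∈ x ∷ X ⇔ q ∈ y ∷ Y) → (∀ q → q ≢ p → q ∈ X ⇔ q ∈ Y)
agree-off-suc⁻ X≈Y q q≢p = ∷-⇔⁻ (X≈Y (suc q) (q≢p ∘ suc-injective))

∣∣-insert : ∀ {L} (X Y : Subset L) (p : Fin L) → p ∉ X → p ∈ Y →
  (∀ q → q ≢ p → q ∈ X ⇔ q ∈ Y) → ∣ Y ∣ ≡ suc ∣ X ∣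
∣∣-insert (inside ∷ X) Y zero p∉X _ _ = contradiction here p∉X
∣∣-insert (outside ∷ X) (inside ∷ Y) zero _ _ X≈Y =
  cong suc (≡.sym (∣∣-cong (λ q → ∷-⇔⁻ (X≈Y (suc q) λ ()))))
∣∣-insert (inside ∷ X) (inside ∷ Y) (suc p) p∉X p∈Y X≈Y =
  cong suc (∣∣-insert X Y p (p∉X ∘ there) (drop-there p∈Y) (agree-off-suc⁻ X≈Y))
∣∣-insert (outside ∷ X) (outside ∷ Y) (suc p) p∉X p∈Y X≈Y =
  ∣∣-insert X Y p (p∉X ∘ there) (drop-there p∈Y) (agree-off-suc⁻ X≈Y)
∣∣-insert (inside ∷ X) (outside ∷ Y) (suc p) _ _ X≈Y = contradiction (to (X≈Y zero λ ()) here) λ ()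
∣∣-insert (outside ∷ X) (inside ∷ Y) (suc p) _ _ X≈Y = contradiction (from (X≈Y zero λ ()) here) λ ()

∈-drop⇔ : ∀ m {n} (A : Subset (m + n)) (i : Fin n) → m ↑ʳ i ∈ A ⇔ i ∈ drop m A
∈-drop⇔ zero A i = ⇔.refl
∈-drop⇔ (suc m) (x ∷ A) i = ⇔.trans (mk⇔ drop-there there) (∈-drop⇔ m A i)

↑ʳ-≢-below : ∀ m {n} (j : Fin n) {u : Fin (m + n)} → toℕ u < m → m ↑ʳ j ≢ u
↑ʳ-≢-below m j {u} u<m m↑ʳj≡u = <⇒≢ u<m↑ʳj (cong toℕ (≡.sym m↑ʳj≡u))
  where
  u<m↑ʳj : toℕ u < toℕ (m ↑ʳ j)
  u<m↑ʳj = <-≤-trans u<m (subst (m ≤_) (≡.sym (toℕ-↑ʳ m j)) (m≤m+n m (toℕ j)))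

↑ʳ-onto-≥ : ∀ m {n} (v : Fin (m + n)) → m ≤ toℕ v → ∃ λ i → m ↑ʳ i ≡ v
↑ʳ-onto-≥ m v m≤v = reduce≥ v m≤v , splitAt⁻¹-↑ʳ (splitAt-≥ m v m≤v)

rSize-move : ∀ m {n} (A A' : Subset (m + n)) (u v : Fin (m + n)) →
  toℕ u < m → m ≤ toℕ v → v ∉ A → v ∈ A' →
  (∀ w → w ≢ u → w ≢ v → w ∈ A ⇔ w ∈ A') →
  rSize m {n} A' ≡ suc (rSize m {n} A)
rSize-move m A A' u v u<m m≤v v∉A v∈A' agree with i , refl ← ↑ʳ-onto-≥ m v m≤v =
  ∣∣-insert (drop m A) (drop m A') i
    (v∉A ∘ from (∈-drop⇔ m A i)) (to (∈-drop⇔ m A' i) v∈A') agree-on-R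
  where
  agree-on-R : ∀ j → j ≢ i → j ∈ drop m A ⇔ j ∈ drop m A'
  agree-on-R j j≢i = begin
    j ∈ drop m A      ∼⟨ ⇔.sym (∈-drop⇔ m A j) ⟩
    m ↑ʳ j ∈ A       ∼⟨ agree (m ↑ʳ j) (↑ʳ-≢-below m j u<m) (j≢i ∘ ↑ʳ-injective m j i) ⟩
    m ↑ʳ j ∈ A'      ∼⟨ ∈-drop⇔ m A' j ⟩
    j ∈ drop m A'     ∎
    where open EquationalReasoning {k = equivalence}

isOdd-suc : ∀ x → isOdd (suc x) ≡ not (isOdd x)
isOdd-suc zero = refl
isOdd-suc (suc zero) = refl
isOdd-suc (suc (suc x)) = isOdd-suc x

isOdd-suc-≢ : ∀ x → isOdd x ≢ isOdd (suc x)
isOdd-suc-≢ x eq = not-¬ refl (trans eq (isOdd-suc x))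

tokenAdj⇒isOdd-rSize-≢ : ∀ m n (G : Graph (m + n)) → IsBipartiteBR m n G →
  ∀ {A A'} → TokenAdj G A A' → isOdd (rSize m {n} A) ≢ isOdd (rSize m {n} A')
tokenAdj⇒isOdd-rSize-≢ m n G bip {A} {A'} (u , v , uv , u∈A , u∉A' , v∈A' , v∉A , agree) eq
  with bip u v uv
... | inj₁ (u∈B , v∉B) =
  isOdd-suc-≢ (rSize m A) (trans eq (cong isOdd
    (rSize-move m A A' u v u∈B (≮⇒≥ v∉B) v∉A v∈A' agree)))
... | inj₂ (u∉B , v∈B) =
  isOdd-suc-≢ (rSize m A') (trans (≡.sym eq) (cong isOdd
    (rSize-move m A' A v u v∈B (≮⇒≥ u∉B) u∉A' u∈A (λ w w≢v w≢u → ⇔.sym (agree w w≢u w≢v)))))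

length-filterᵇ : ∀ {a} {X : Set a} (p : X → Bool) (xs : List X) → length (filterᵇ p xs) ≡ countᵇ p xs
length-filterᵇ p [] = refl
length-filterᵇ p (x ∷ xs) with p x
... | true  = cong suc (length-filterᵇ p xs)
... | false = length-filterᵇ p xs

allSubsets-unique : ∀ N → Unique (allSubsets N)
allSubsets-unique zero = [] ∷ []
allSubsets-unique (suc N) = Unique.++⁺ (prefixed-unique true) (prefixed-unique false) disjoint
  where
  ∷-injectiveʳ : ∀ {b} {X Y : Subset N} → b ∷ X ≡ b ∷ Y → X ≡ Y
  ∷-injectiveʳ refl = refl
  prefixed-unique : ∀ b → Unique (map (b ∷_) (allSubsets N))
  prefixed-unique b = Unique.map⁺ ∷-injectiveʳ (allSubsets-unique N)
  disjoint : ∀ {A} → ¬ (A ∈ₗ map (true ∷_) (allSubsets N) × A ∈ₗ map (false ∷_) (allSubsets N))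
  disjoint (A∈₁ , A∈₂) with ∈-map⁻ (true ∷_) A∈₁ | ∈-map⁻ (false ∷_) A∈₂
  ... | _ , _ , refl | _ , _ , ()

IsTokenIndep-antimono : ∀ {N} (G G' : Graph N) → Subgraph G G' →
  ∀ {k S} → IsTokenIndep G' k S → IsTokenIndep G k S
IsTokenIndep-antimono G G' G⊆G' (unique , sizes , indep) =
  unique , sizes , λ A∈ A'∈ (u , v , uv , rest) → indep A∈ A'∈ (u , v , G⊆G' u v uv , rest)

filterᵇ-tokenIndep : ∀ m n k (G : Graph (m + n)) → IsBipartiteBR m n G →
  (p : Subset (m + n) → Bool) (c : Bool) →
  (∀ A → T (p A) → ∣ A ∣ ≡ k × isOdd (rSize m {n} A) ≡ c) →
  IsTokenIndep G k (filterᵇ p (allSubsets (m + n)))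
filterᵇ-tokenIndep m n k G bip p c class =
  Unique.filter⁺ (T? ∘ p) {xs = allSubsets (m + n)} (allSubsets-unique (m + n)) ,
  All.tabulate (λ A∈ → proj₁ (class-of A∈)) ,
  λ A∈ A'∈ A~A' → tokenAdj⇒isOdd-rSize-≢ m n G bip A~A'
    (trans (proj₂ (class-of A∈)) (≡.sym (proj₂ (class-of A'∈))))
  where
  class-of : ∀ {A} → A ∈ₗ filterᵇ p (allSubsets (m + n)) → ∣ A ∣ ≡ k × isOdd (rSize m {n} A) ≡ c
  class-of {A} A∈ = class A (proj₂ (∈-filter⁻ (T? ∘ p) {xs = allSubsets (m + n)} A∈))

T-if-else-false : ∀ {b c} → T (if b then c else false) → T b × T c
T-if-else-false {true} t = tt , t

𝓡-tokenIndep : ∀ m n k (G : Graph (m + n)) → IsBipartiteBR m n G →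
  ∃ λ S → IsTokenIndep G k S × length S ≡ countR m n k
𝓡-tokenIndep m n k G bip =
  filterᵇ in𝓡 subsets , filterᵇ-tokenIndep m n k G bip in𝓡 true 𝓡-class , length-filterᵇ in𝓡 subsets
  where
  subsets = allSubsets (m + n)
  in𝓡 : Subset (m + n) → Bool
  in𝓡 A = if isK k A then isOdd (rSize m {n} A) else false
  𝓡-class : ∀ A → T (in𝓡 A) → ∣ A ∣ ≡ k × isOdd (rSize m {n} A) ≡ true
  𝓡-class A t with isK , odd ← T-if-else-false t = ≡ᵇ⇒≡ ∣ A ∣ k isK , to T-≡ odd

𝓑-tokenIndep : ∀ m n k (G : Graph (m + n)) → IsBipartiteBR m n G →
  ∃ λ S → IsTokenIndep G k S × length S ≡ countB m n k
𝓑-tokenIndep m n k G bip =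
  filterᵇ in𝓑 subsets , filterᵇ-tokenIndep m n k G bip in𝓑 false 𝓑-class , length-filterᵇ in𝓑 subsets
  where
  subsets = allSubsets (m + n)
  in𝓑 : Subset (m + n) → Bool
  in𝓑 A = if isK k A then not (isOdd (rSize m {n} A)) else false
  𝓑-class : ∀ A → T (in𝓑 A) → ∣ A ∣ ≡ k × isOdd (rSize m {n} A) ≡ false
  𝓑-class A t with isK , even ← T-if-else-false t = ≡ᵇ⇒≡ ∣ A ∣ k isK , to T-not-≡ even

largestParityClass-tokenIndep : ∀ m n k (G : Graph (m + n)) → IsBipartiteBR m n G →
  ∃ λ S → IsTokenIndep G k S × length S ≡ countR m n k ⊔ countB m n k
largestParityClass-tokenIndep m n k G bip with ≤-total (countR m n k) (countB m n k)
... | inj₁ 𝓡≤𝓑 = let S , indep , |S| = 𝓑-tokenIndep m n k G bip in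
  S , indep , trans |S| (≡.sym (m≤n⇒m⊔n≡n 𝓡≤𝓑))
... | inj₂ 𝓑≤𝓡 = let S , indep , |S| = 𝓡-tokenIndep m n k G bip in
  S , indep , trans |S| (≡.sym (m≥n⇒m⊔n≡m 𝓑≤𝓡))

proposition3p9 : (m n k : ℕ) → 1 ≤ m → 1 ≤ n → m ≤ n → 1 ≤ k → k ≤ m + n ∸ 1 →
    (G G' : Graph (m + n)) → IsBipartiteBR m n G → IsBipartiteBR m n G' → Subgraph G G' →
    IndepNumberToken G k (countR m n k ⊔ countB m n k) →
    IndepNumberToken G' k (countR m n k ⊔ countB m n k)
proposition3p9 m n k _ _ _ _ _ G G' _ bip' G⊆G' (_ , β≤) =
  largestParityClass-tokenIndep m n k G' bip' ,
  λ S indep' → β≤ S (IsTokenIndep-antimono G G' G⊆G' indep')
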